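{- Let $\mathfrak{p}_n$ be defined as below. Then \[ \mathfrak{p}_n = \prod_{\substack{p \leq \frac{n+1}{4} \\ s_p(n) \geq p}} p \] (product over primes $p$) holds in each of the following cases: (a) $n = 4$; (b) $n \geq 10$ is even and $n \notin \bigcup_{p \geq 5 \text{ prime}} \{3p-1, 4p-2\}$; (c) $n \geq 11$ is odd and $n \notin \bigcup_{p \geq 5 \text{ prime}} \{2p-1, 3p-2, 4p-3\}$.
   Context: For a prime $p$ and an integer $n \geq 0$, $s_p(n)$ denotes the sum of the digits of $n$ in base $p$. For $n \geq 1$ define $\mathfrak{p}_n := \prod_{p \text{ prime},\ s_p(n) \geq p} p$ (a finite product; the empty product is $1$). -}

module Defs where

open import Data.Nat using (ℕ; zero; suc; _+_; _*_; _≤_; _≤?_; _/_; _%_)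
open import Data.Nat.Primality using (Prime; prime?)
open import Data.List using (List; upTo; filter; map)
open import Data.Nat.ListAction using (product)
open import Level using (0ℓ)
open import Relation.Nullary.Decidable using (Dec; _×-dec_)
open import Relation.Unary using (Pred; Decidable)

-- digitSumAux fuel p n : sum of base-p digits of n, given enough fuel (fuel ≥ n).
-- For p ≤ 1 the base is degenerate; only used for primes p ≥ 2.
digitSumAux : ℕ → (p : ℕ) → ℕ → ℕ
digitSumAux zero    p n = 0
digitSumAux (suc f) zero n = 0
digitSumAux (suc f) (suc zero) n = 0
digitSumAux (suc f) p@(suc (suc k)) zero = 0
digitSumAux (suc f) p@(suc (suc k)) n@(suc _) = n % p + digitSumAux f p (n / p)

-- s_p(n): sum of the digits of n in base p (fuel n suffices since n / p < n for n ≥ 1, p ≥ 2)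
s : (p n : ℕ) → ℕ
s p n = digitSumAux n p n

primeProd : ℕ → {P : Pred ℕ 0ℓ} → Decidable P → ℕ
primeProd B P? = product (filter (λ p → prime? p ×-dec P? p) (upTo (suc B)))

-- 𝔭_n = ∏_{p prime, s_p(n) ≥ p} p.
-- Every prime p contributing satisfies p ≤ s_p(n) ≤ n, so it is enough to range over p ≤ n.
𝔭 : ℕ → ℕ
𝔭 n = primeProd n (λ p → p ≤? s p n)

-- ∏_{p prime, p ≤ (n+1)/4, s_p(n) ≥ p} p   (p ≤ (n+1)/4 written as 4p ≤ n+1)
𝔭small : ℕ → ℕ
𝔭small n = primeProd n (λ p → (4 * p ≤? n + 1) ×-dec (p ≤? s p n))

module Submission where

-- Both 𝔭 n and 𝔭small n are products over the list of primes
-- p ≤ n with s_p(n) ≥ p; the second list additionally demands 4p ≤ n + 1.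
-- So it suffices to show that no contributing prime has 4p > n + 1.
--
-- Such a prime p ≥ 4 makes n a two-digit number a·p + b in base p with
-- a = n / p ≤ 3, and s_p(n) = a + b ≥ p says exactly that n + j = (a+1)·p
-- for some 1 ≤ j ≤ a.  Discarding n + 1 = 4p leaves five positions
-- (n+1 = 2p, 3p;  n+2 = 3p, 4p;  n+3 = 4p), see BelowSmallMultiple.
-- For odd p, parity kills half of them and the hypotheses of (b)/(c)
-- exclude the rest.  The primes p ≤ 3 force n = 10, where one computes
-- s_3(10) = 2 < 3.  Case (a), n = 4, is a direct computation.

open import Defs
open import Data.Nat using (ℕ; _+_; _*_; _∸_; _≤_; _≡ᵇ_)
open import Data.Nat.Primality using (Prime)
open import Data.Nat.Divisibility using (_∣_)
open import Data.Product using (_×_)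
open import Data.Sum using (_⊎_)
open import Relation.Nullary using (¬_)
open import Relation.Binary.PropositionalEquality using (_≡_)

open import Data.Nat using (zero; suc; _<_; _≤?_; _/_; _%_; z≤n; s≤s)
open import Data.Nat.Properties
open import Data.Nat.DivMod using (m≡m%n+[m/n]*n; m%n<n; m<n⇒m%n≡m; m<n⇒m/n≡0; m<n*o⇒m/o<n)
open import Data.Nat.Divisibility using (divides; _∣0; ∣-refl; ∣-trans; ∣1⇒≡1; ∣m∣n⇒∣m+n; ∣m+n∣m⇒∣n; m∣m*n)
open import Data.Nat.Primality using (prime?; prime[2]; prime⇒irreducible; euclidsLemma)
open import Data.Nat.ListAction using (product)
open import Data.List using (upTo)
open import Data.List.Properties using (filter-≐)
open import Data.Product using (_,_; ∃-syntax)
open import Data.Sum using (inj₁; inj₂; [_,_]′)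
open import Data.Empty using (⊥)
open import Function using (id)
open import Relation.Nullary using (yes; no; contradiction)
open import Relation.Nullary.Decidable using (_×-dec_)
open import Relation.Unary using (Decidable; _⊆_)
open import Relation.Binary.PropositionalEquality using (refl; sym; trans; cong; cong₂; subst; module ≡-Reasoning)

data BelowSmallMultiple (n p : ℕ) : Set where
  n+1≡2p : n + 1 ≡ 2 * p → BelowSmallMultiple n p
  n+1≡3p : n + 1 ≡ 3 * p → BelowSmallMultiple n p
  n+2≡3p : n + 2 ≡ 3 * p → BelowSmallMultiple n p
  n+2≡4p : n + 2 ≡ 4 * p → BelowSmallMultiple n p
  n+3≡4p : n + 3 ≡ 4 * p → BelowSmallMultiple n p

belowMultiple⇒belowSmallMultiple : ∀ {n p} a j → 1 ≤ j → j ≤ a → a < 4 →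
  n + j ≡ suc a * p → n + 1 < 4 * p → BelowSmallMultiple n p
belowMultiple⇒belowSmallMultiple 1 1 _ _ _ eq _ = n+1≡2p eq
belowMultiple⇒belowSmallMultiple 2 1 _ _ _ eq _ = n+1≡3p eq
belowMultiple⇒belowSmallMultiple 2 2 _ _ _ eq _ = n+2≡3p eq
belowMultiple⇒belowSmallMultiple 3 1 _ _ _ eq n+1<4p = contradiction n+1<4p (<-irrefl eq)
belowMultiple⇒belowSmallMultiple 3 2 _ _ _ eq _ = n+2≡4p eq
belowMultiple⇒belowSmallMultiple 3 3 _ _ _ eq _ = n+3≡4p eq
belowMultiple⇒belowSmallMultiple a 0 1≤j _ _ _ _ = contradiction 1≤j λ ()
belowMultiple⇒belowSmallMultiple 0 (suc j) _ j≤a _ _ _ = contradiction j≤a λ ()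
belowMultiple⇒belowSmallMultiple 1 (suc (suc j)) _ (s≤s j≤0) _ _ _ = contradiction j≤0 λ ()
belowMultiple⇒belowSmallMultiple 2 (suc (suc (suc j))) _ (s≤s (s≤s j≤0)) _ _ _ = contradiction j≤0 λ ()
belowMultiple⇒belowSmallMultiple 3 (suc (suc (suc (suc j)))) _ (s≤s (s≤s (s≤s j≤0))) _ _ _ =
  contradiction j≤0 λ ()
belowMultiple⇒belowSmallMultiple (suc (suc (suc (suc a)))) _ _ _ a<4 _ _ =
  contradiction a<4 (≤⇒≯ (s≤s (s≤s (s≤s (s≤s z≤n)))))

module Base (k : ℕ) where

  p : ℕ
  p = suc (suc k)

  digitSumAux-zero : ∀ f → digitSumAux f p 0 ≡ 0
  digitSumAux-zero zero    = refl
  digitSumAux-zero (suc f) = refl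

  digitSum-digit : ∀ f a → a < p → digitSumAux (suc f) p a ≡ a
  digitSum-digit f zero    _   = refl
  digitSum-digit f (suc a) a<p = begin
    suc a % p + digitSumAux f p (suc a / p)
      ≡⟨ cong₂ _+_ (m<n⇒m%n≡m a<p) (cong (digitSumAux f p) (m<n⇒m/n≡0 a<p)) ⟩
    suc a + digitSumAux f p 0  ≡⟨ cong (suc a +_) (digitSumAux-zero f) ⟩
    suc a + 0                  ≡⟨ +-identityʳ (suc a) ⟩
    suc a                      ∎
    where open ≡-Reasoning

  digitSum-twoDigits : ∀ n → n / p < p → s p n ≡ n % p + n / p
  digitSum-twoDigits zero          _   = refl
  digitSum-twoDigits (suc zero)    _   = cong (1 % p +_) (sym (m<n⇒m/n≡0 {1} {p} (s≤s (s≤s z≤n))))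
  digitSum-twoDigits (suc (suc m)) a<p = cong (suc (suc m) % p +_) (digitSum-digit m _ a<p)

  -- If n = a·p + b is two-digit and a + b ≥ p, then n sits j steps below
  -- the multiple (a+1)·p for some 1 ≤ j ≤ a; namely j = p − b.
  largeDigitSum⇒belowMultiple : ∀ n → n / p < p → p ≤ s p n →
    ∃[ j ] 1 ≤ j × j ≤ n / p × n + j ≡ suc (n / p) * p
  largeDigitSum⇒belowMultiple n a<p p≤s =
    p ∸ b , m<n⇒0<n∸m b<p , m≤n+o⇒m∸n≤o p b p≤b+a , n+j≡[a+1]p
    where
    open ≡-Reasoning
    a = n / p
    b = n % p
    b<p : b < p
    b<p = m%n<n n p
    p≤b+a : p ≤ b + a
    p≤b+a = subst (p ≤_) (digitSum-twoDigits n a<p) p≤s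
    n+j≡[a+1]p : n + (p ∸ b) ≡ suc a * p
    n+j≡[a+1]p = begin
      n + (p ∸ b)           ≡⟨ cong (_+ (p ∸ b)) (m≡m%n+[m/n]*n n p) ⟩
      b + a * p + (p ∸ b)   ≡⟨ cong (_+ (p ∸ b)) (+-comm b (a * p)) ⟩
      a * p + b + (p ∸ b)   ≡⟨ +-assoc (a * p) b (p ∸ b) ⟩
      a * p + (b + (p ∸ b)) ≡⟨ cong (a * p +_) (m+[n∸m]≡n (<⇒≤ b<p)) ⟩
      a * p + p             ≡⟨ +-comm (a * p) p ⟩
      suc a * p             ∎

  largeBase⇒belowSmallMultiple : ∀ n → 4 ≤ p → n + 1 < 4 * p → p ≤ s p n → BelowSmallMultiple n p
  largeBase⇒belowSmallMultiple n 4≤p n+1<4p p≤s =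
    let j , 1≤j , j≤a , eq = largeDigitSum⇒belowMultiple n (<-≤-trans a<4 4≤p) p≤s
    in  belowMultiple⇒belowSmallMultiple (n / p) j 1≤j j≤a a<4 eq n+1<4p
    where
    a<4 : n / p < 4
    a<4 = m<n*o⇒m/o<n (<-trans (m<m+n n (s≤s z≤n)) n+1<4p)

even⊎even-suc : ∀ n → 2 ∣ n ⊎ 2 ∣ suc n
even⊎even-suc zero    = inj₁ (2 ∣0)
even⊎even-suc (suc n) = [ (λ 2∣n → inj₂ (∣m∣n⇒∣m+n ∣-refl 2∣n)) , inj₁ ]′ (even⊎even-suc n)

odd⇒even-suc : ∀ {n} → ¬ 2 ∣ n → 2 ∣ n + 1
odd⇒even-suc {n} 2∤n =
  [ (λ 2∣n → contradiction 2∣n 2∤n) , subst (2 ∣_) (+-comm 1 n) ]′ (even⊎even-suc n)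

¬2∣1 : ¬ 2 ∣ 1
¬2∣1 2∣1 = contradiction (∣1⇒≡1 2∣1) λ ()

¬2∣3 : ¬ 2 ∣ 3
¬2∣3 2∣3 = ¬2∣1 (∣m+n∣m⇒∣n 2∣3 ∣-refl)

2∣4* : ∀ p → 2 ∣ 4 * p
2∣4* p = ∣-trans (divides 2 refl) (m∣m*n p)

prime⇒odd : ∀ {p} → Prime p → 3 ≤ p → ¬ 2 ∣ p
prime⇒odd pp 3≤p 2∣p = [ (λ ()) , (λ 2≡p → <-irrefl 2≡p 3≤p) ]′ (prime⇒irreducible pp 2∣p)

even-*-odd : ∀ c {p} → ¬ 2 ∣ p → 2 ∣ c * p → 2 ∣ c
even-*-odd c 2∤p 2∣cp = [ id , (λ 2∣p → contradiction 2∣p 2∤p) ]′ (euclidsLemma c _ prime[2] 2∣cp)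

m+n≡o⇒m≡o∸n : ∀ {m n o} → m + n ≡ o → m ≡ o ∸ n
m+n≡o⇒m≡o∸n {m} {n} eq = sym (subst (λ o → o ∸ n ≡ m) eq (m+n∸n≡m m n))

even-belowSmallMultiple : ∀ {n p} → 2 ∣ n → ¬ 2 ∣ p → BelowSmallMultiple n p →
  n ≡ 3 * p ∸ 1 ⊎ n ≡ 4 * p ∸ 2
even-belowSmallMultiple {p = p} 2∣n _ (n+1≡2p eq) =
  contradiction (∣m+n∣m⇒∣n (subst (2 ∣_) (sym eq) (m∣m*n p)) 2∣n) ¬2∣1
even-belowSmallMultiple _ _ (n+1≡3p eq) = inj₁ (m+n≡o⇒m≡o∸n eq)
even-belowSmallMultiple 2∣n 2∤p (n+2≡3p eq) =
  contradiction (even-*-odd 3 2∤p (subst (2 ∣_) eq (∣m∣n⇒∣m+n 2∣n ∣-refl))) ¬2∣3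
even-belowSmallMultiple _ _ (n+2≡4p eq) = inj₂ (m+n≡o⇒m≡o∸n eq)
even-belowSmallMultiple {p = p} 2∣n _ (n+3≡4p eq) =
  contradiction (∣m+n∣m⇒∣n (subst (2 ∣_) (sym eq) (2∣4* p)) 2∣n) ¬2∣3

odd-belowSmallMultiple : ∀ {n p} → ¬ 2 ∣ n → ¬ 2 ∣ p → BelowSmallMultiple n p →
  n ≡ 2 * p ∸ 1 ⊎ n ≡ 3 * p ∸ 2 ⊎ n ≡ 4 * p ∸ 3
odd-belowSmallMultiple _ _ (n+1≡2p eq) = inj₁ (m+n≡o⇒m≡o∸n eq)
odd-belowSmallMultiple 2∤n 2∤p (n+1≡3p eq) =
  contradiction (even-*-odd 3 2∤p (subst (2 ∣_) eq (odd⇒even-suc 2∤n))) ¬2∣3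
odd-belowSmallMultiple _ _ (n+2≡3p eq) = inj₂ (inj₁ (m+n≡o⇒m≡o∸n eq))
odd-belowSmallMultiple {n} {p} 2∤n _ (n+2≡4p eq) =
  contradiction (∣m+n∣m⇒∣n (subst (2 ∣_) (trans (sym eq) (+-comm n 2)) (2∣4* p)) ∣-refl) 2∤n
odd-belowSmallMultiple _ _ (n+3≡4p eq) = inj₂ (inj₂ (m+n≡o⇒m≡o∸n eq))

evenCase-noBelow : ∀ {n} → 2 ∣ n →
  (∀ p → Prime p → 5 ≤ p → ¬ (n ≡ 3 * p ∸ 1) × ¬ (n ≡ 4 * p ∸ 2)) →
  ∀ p → Prime p → 5 ≤ p → ¬ BelowSmallMultiple n p
evenCase-noBelow 2∣n excluded p pp 5≤p below =
  let ≢3p-1 , ≢4p-2 = excluded p pp 5≤p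
  in  [ ≢3p-1 , ≢4p-2 ]′ (even-belowSmallMultiple 2∣n (prime⇒odd pp (≤-trans (m≤m+n 3 2) 5≤p)) below)

oddCase-noBelow : ∀ {n} → ¬ 2 ∣ n →
  (∀ p → Prime p → 5 ≤ p → ¬ (n ≡ 2 * p ∸ 1) × ¬ (n ≡ 3 * p ∸ 2) × ¬ (n ≡ 4 * p ∸ 3)) →
  ∀ p → Prime p → 5 ≤ p → ¬ BelowSmallMultiple n p
oddCase-noBelow 2∤n excluded p pp 5≤p below =
  let ≢2p-1 , ≢3p-2 , ≢4p-3 = excluded p pp 5≤p
  in  [ ≢2p-1 , [ ≢3p-2 , ≢4p-3 ]′ ]′ (odd-belowSmallMultiple 2∤n (prime⇒odd pp (≤-trans (m≤m+n 3 2) 5≤p)) below)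

largeBase⇒belowSmallMultiple : ∀ {n} p → 4 ≤ p → n + 1 < 4 * p → p ≤ s p n → BelowSmallMultiple n p
largeBase⇒belowSmallMultiple 0 ()
largeBase⇒belowSmallMultiple 1 (s≤s ())
largeBase⇒belowSmallMultiple {n} (suc (suc k)) = Base.largeBase⇒belowSmallMultiple k n

-- At n = 10, a base p ≤ 3 with 4p > 11 is p = 3, and s_3(10) = 2 < 3 (by computation).
smallBase-at10 : ∀ p → p ≤ 3 → 10 + 1 < 4 * p → p ≤ s p 10 → ⊥
smallBase-at10 0 _ 11<4p _ = ≤⇒≤ᵇ 11<4p
smallBase-at10 1 _ 11<4p _ = ≤⇒≤ᵇ 11<4p
smallBase-at10 2 _ 11<4p _ = ≤⇒≤ᵇ 11<4p
smallBase-at10 3 _ _ 3≤s = ≤⇒≤ᵇ 3≤s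
smallBase-at10 (suc (suc (suc (suc _)))) p≤3 _ _ = ≤⇒≤ᵇ p≤3

-- For n ≥ 10 a base p ≤ 3 with 4p > n + 1 forces n = 10, so it does not contribute.
smallBase-excluded : ∀ {n p} → 10 ≤ n → p ≤ 3 → n + 1 < 4 * p → p ≤ s p n → ⊥
smallBase-excluded {n} {p} 10≤n p≤3 n+1<4p p≤s =
  smallBase-at10 p p≤3 (subst (λ m → m + 1 < 4 * p) n≡10 n+1<4p) (subst (λ m → p ≤ s p m) n≡10 p≤s)
  where
  n≡10 : n ≡ 10
  n≡10 = ≤-antisym (+-cancelʳ-≤ 1 n 10 (≤-pred (≤-trans n+1<4p (*-monoʳ-≤ 4 p≤3)))) 10≤n

prime≥4⇒≥5 : ∀ {p} → Prime p → 4 ≤ p → 5 ≤ p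
prime≥4⇒≥5 pp 4≤p = ≤∧≢⇒< 4≤p λ { refl → prime⇒odd pp (s≤s (s≤s (s≤s z≤n))) (divides 2 refl) }

contributingPrime-bound : ∀ {n} → 10 ≤ n → (∀ p → Prime p → 5 ≤ p → ¬ BelowSmallMultiple n p) →
  ∀ p → Prime p → p ≤ s p n → 4 * p ≤ n + 1
contributingPrime-bound {n} 10≤n noBelow p pp p≤s with 4 * p ≤? n + 1 | p ≤? 3
... | yes 4p≤n+1 | _       = 4p≤n+1
... | no 4p≰n+1  | yes p≤3 = contradiction p≤s (smallBase-excluded 10≤n p≤3 (≰⇒> 4p≰n+1))
... | no 4p≰n+1  | no p≰3  =
  contradiction (largeBase⇒belowSmallMultiple p (≰⇒> p≰3) (≰⇒> 4p≰n+1) p≤s)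
                (noBelow p pp (prime≥4⇒≥5 pp (≰⇒> p≰3)))

𝔭≡𝔭small : ∀ {n} → (∀ p → Prime p → p ≤ s p n → 4 * p ≤ n + 1) → 𝔭 n ≡ 𝔭small n
𝔭≡𝔭small {n} bound = cong product (filter-≐ contributes? contributesSmall? (toSmall , fromSmall) (upTo (suc n)))
  where
  Contributes ContributesSmall : ℕ → Set
  Contributes p = Prime p × p ≤ s p n
  ContributesSmall p = Prime p × 4 * p ≤ n + 1 × p ≤ s p n

  contributes? : Decidable Contributes
  contributes? p = prime? p ×-dec (p ≤? s p n)
  contributesSmall? : Decidable ContributesSmall
  contributesSmall? p = prime? p ×-dec ((4 * p ≤? n + 1) ×-dec (p ≤? s p n))

  toSmall : Contributes ⊆ ContributesSmall
  toSmall {p} (pp , p≤s) = pp , bound p pp p≤s , p≤s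
  fromSmall : ContributesSmall ⊆ Contributes
  fromSmall (pp , _ , p≤s) = pp , p≤s

theorem3 : (n : ℕ) →
    ( n ≡ 4
    ⊎ (10 ≤ n × 2 ∣ n × (∀ p → Prime p → 5 ≤ p → ¬ (n ≡ 3 * p ∸ 1) × ¬ (n ≡ 4 * p ∸ 2)))
    ⊎ (11 ≤ n × ¬ (2 ∣ n) × (∀ p → Prime p → 5 ≤ p → ¬ (n ≡ 2 * p ∸ 1) × ¬ (n ≡ 3 * p ∸ 2) × ¬ (n ≡ 4 * p ∸ 3))) ) →
    𝔭 n ≡ 𝔭small n
theorem3 n (inj₁ refl) = refl
theorem3 n (inj₂ (inj₁ (10≤n , 2∣n , excluded))) =
  𝔭≡𝔭small (contributingPrime-bound 10≤n (evenCase-noBelow 2∣n excluded))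
theorem3 n (inj₂ (inj₂ (11≤n , 2∤n , excluded))) =
  𝔭≡𝔭small (contributingPrime-bound (≤-trans (n≤1+n 10) 11≤n) (oddCase-noBelow 2∤n excluded))
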